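{- Let $\Gamma=\{\alpha_i\}_{i\in I}\subseteq S_c[X]$ and $\beta\in S_c[X]$. Then $\Gamma\vdash\beta$ if and only if there exist a finite subset $J\subseteq I$, a positive integer $N$, and subsets $B_i^{(N)}$ ($i\in J$) and $B^{(N)}$ of $\{0,1,\dots,2^N-1\}$ such that $\alpha_i=\overline{(\sum^\circ_{j\in B_i^{(N)}}y_j^{(N)},N)}$ for all $i\in J$, $\beta=\overline{(\sum^\circ_{j\in B^{(N)}}y_j^{(N)},N)}$, and $\bigcap_{i\in J}B_i^{(N)}\subseteq B^{(N)}$.
   Context: A semiring is a set with operations $\circ$ (commutative monoid, identity $\theta$) and $\cdot$ (monoid, identity $1$), $\cdot$ distributing over $\circ$ on both sides, $\theta$ absorbing for $\cdot$, $1\ne\theta$. Let $X=\{x_1,x_2,\dots\}$ be countable. For $N\ge1$ let $S_c[X_N]$ be the quotient of the free commutative semiring on $\{x_1,\dots,x_N,x_1^c,\dots,x_N^c\}$ by the congruence generated by $(x_i\cdot x_i^c,\theta)$, $(x_i\circ x_i^c,1)$, $(x_i\circ x_i,x_i)$, $(x_i^c\circ x_i^c,x_i^c)$, $1\le i\le N$. For $k=\sum_{l=1}^N j_l2^{l-1}$, $j_l\in\{0,1\}$, put $y_k^{(N)}=x_1^{j_1}\cdots x_N^{j_N}$ with $x_l^1=x_l$, $x_l^0=x_l^c$; every element of $S_c[X_N]$ is uniquely $\sum^\circ_{k\in D}y_k^{(N)}$ with $D\subseteq\{0,\dots,2^N-1\}$ (empty sum $=\theta$). For $N\le M$ let $f_{NM}:S_c[X_N]\to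 S_c[X_M]$ be the homomorphism induced by $x_i\mapsto x_i,x_i^c\mapsto x_i^c$. $S_c[X]$ (the free I-C semiring on $X$) is the direct limit: classes $\overline{(a,i)}$, $a\in S_c[X_i]$, with $(a,i)\sim(b,j)$ iff $f_{ik}(a)=f_{jk}(b)$ for some $k\ge i,j$, operations computed at a common level. For $\Gamma\subseteq S_c[X]$ let $\equiv_\Gamma$ be the congruence on $S_c[X]$ generated by $\{(\gamma,1):\gamma\in\Gamma\}$; $\Gamma\vdash\beta$ means $\beta\equiv_\Gamma1$. An intersection over the empty index set is taken to be $\{0,\dots,2^N-1\}$. -}

module Defs where

open import Data.Nat using (ℕ; zero; suc; _≤_; s≤s; _⊔_; _^_; _/_; _%_; _≡ᵇ_)
open import Data.Nat.Properties using (m≤m⊔n; m≤n⊔m)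
open import Data.Fin using (Fin; toℕ; inject≤)
import Data.Fin as F
open import Data.Fin.Subset using (Subset; _∈_)
open import Data.Bool using (Bool; true; false)
open import Data.Vec using ([]; _∷_)
open import Data.Product using (Σ; ∃; ∃-syntax; _×_; _,_; proj₁; proj₂)

-- Terms of the free commutative semiring on x_1..x_N, x_1^c..x_N^c
-- (generator x_{l+1} is  var l  for l : Fin N).

infixl 6 _∘_
infixl 7 _·_

data Term (N : ℕ) : Set where
  var  : Fin N → Term N
  cvar : Fin N → Term N
  θ    : Term N
  one  : Term N
  _∘_  : Term N → Term N → Term N
  _·_  : Term N → Term N → Term N

infix 4 _≈_
data _≈_ {N : ℕ} : Term N → Term N → Set where
  ≈-refl   : ∀ {a} → a ≈ a
  ≈-sym    : ∀ {a b} → a ≈ b → b ≈ a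
  ≈-trans  : ∀ {a b c} → a ≈ b → b ≈ c → a ≈ c
  ∘-cong   : ∀ {a a' b b'} → a ≈ a' → b ≈ b' → a ∘ b ≈ a' ∘ b'
  ·-cong   : ∀ {a a' b b'} → a ≈ a' → b ≈ b' → a · b ≈ a' · b'
  ∘-assoc  : ∀ a b c → (a ∘ b) ∘ c ≈ a ∘ (b ∘ c)
  ∘-comm   : ∀ a b → a ∘ b ≈ b ∘ a
  ∘-identˡ : ∀ a → θ ∘ a ≈ a
  ·-assoc  : ∀ a b c → (a · b) · c ≈ a · (b · c)
  ·-comm   : ∀ a b → a · b ≈ b · a
  ·-identˡ : ∀ a → one · a ≈ a
  ·-identʳ : ∀ a → a · one ≈ a
  distribˡ : ∀ a b c → a · (b ∘ c) ≈ (a · b) ∘ (a · c)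
  distribʳ : ∀ a b c → (b ∘ c) · a ≈ (b · a) ∘ (c · a)
  zeroˡ    : ∀ a → θ · a ≈ θ
  zeroʳ    : ∀ a → a · θ ≈ θ
  compl-·  : ∀ i → var i · cvar i ≈ θ
  compl-∘  : ∀ i → var i ∘ cvar i ≈ one
  idem     : ∀ i → var i ∘ var i ≈ var i
  idemᶜ    : ∀ i → cvar i ∘ cvar i ≈ cvar i

emb : ∀ {N M} → N ≤ M → Term N → Term M
emb le (var i)  = var (inject≤ i le)
emb le (cvar i) = cvar (inject≤ i le)
emb le θ        = θ
emb le one      = one
emb le (a ∘ b)  = emb le a ∘ emb le b
emb le (a · b)  = emb le a · emb le b

-- testBit k l = j_{l+1}, the coefficient of 2^l in the binary expansion of k
testBit : ℕ → ℕ → Bool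
testBit k zero    = (k % 2) ≡ᵇ 1
testBit k (suc l) = testBit (k / 2) l

-- x_l^1 = x_l, x_l^0 = x_l^c
lit : ∀ {M} → Fin M → Bool → Term M
lit l true  = var l
lit l false = cvar l

prod : ∀ {M} (n : ℕ) → (Fin n → Term M) → Term M
prod zero    f = one
prod (suc n) f = f F.zero · prod n (λ i → f (F.suc i))

-- y_k^{(N)} = x_1^{j_1} ⋯ x_N^{j_N}
y : (N : ℕ) → Fin (2 ^ N) → Term N
y N k = prod N (λ l → lit l (testBit (toℕ k) (toℕ l)))

sumSub : ∀ {M n} → Subset n → (Fin n → Term M) → Term M
sumSub []            f = θ
sumSub (true  ∷ D)   f = f F.zero ∘ sumSub D (λ i → f (F.suc i))
sumSub (false ∷ D)   f = sumSub D (λ i → f (F.suc i))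

-- The direct limit S_c[X].  A representative (a , N) with N ≥ 1 is
-- encoded as (n , a) with N = suc n and a : Term (suc n).

ScX : Set
ScX = Σ ℕ (λ n → Term (suc n))

infix 4 _~_
_~_ : ScX → ScX → Set
(n , a) ~ (m , b) = ∃[ k ] Σ (suc n ≤ k) (λ p → Σ (suc m ≤ k) (λ q → emb p a ≈ emb q b))

_⊕_ : ScX → ScX → ScX
(n , a) ⊕ (m , b) = (n ⊔ m , emb (s≤s (m≤m⊔n n m)) a ∘ emb (s≤s (m≤n⊔m n m)) b)

_⊗_ : ScX → ScX → ScX
(n , a) ⊗ (m , b) = (n ⊔ m , emb (s≤s (m≤m⊔n n m)) a · emb (s≤s (m≤n⊔m n m)) b)

oneX : ScX
oneX = (0 , one)

data _≡[_]_ {I : Set} : ScX → (I → ScX) → ScX → Set where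
  gen    : ∀ {α} i → α i ≡[ α ] oneX
  ≡-eq   : ∀ {α a b} → a ~ b → a ≡[ α ] b
  ≡-sym  : ∀ {α a b} → a ≡[ α ] b → b ≡[ α ] a
  ≡-trans : ∀ {α a b c} → a ≡[ α ] b → b ≡[ α ] c → a ≡[ α ] c
  ⊕-cong : ∀ {α a a' b b'} → a ≡[ α ] a' → b ≡[ α ] b' → (a ⊕ b) ≡[ α ] (a' ⊕ b')
  ⊗-cong : ∀ {α a a' b b'} → a ≡[ α ] a' → b ≡[ α ] b' → (a ⊗ b) ≡[ α ] (a' ⊗ b')

infix 4 _⊢_
_⊢_ : {I : Set} → (I → ScX) → ScX → Set
α ⊢ β = β ≡[ α ] oneX

nf : (n : ℕ) → Subset (2 ^ suc n) → ScX
nf n D = (n , sumSub D (y (suc n)))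

-- Interpret terms as Boolean functions of the generators (x_i ↦ ρ i, x_i^c ↦ ¬ ρ i,
-- ∘ ↦ ∨, · ↦ ∧). This is sound, and it is complete because every term equals the
-- ∘-sum of the minterms y_k at which it is true: multiplying a by 1 = ∑°_k y_k, each
-- y_k · a collapses to y_k or θ. So S_c[X] is the free Boolean algebra on X and
-- ~ is equality of Boolean functions on assignments ℕ → Bool.
--
-- A derivation of β ≡_Γ 1 uses finitely many generators α_i, and by induction on it
-- β is true under every assignment making those α_i true. At a level N above all
-- of them this says exactly that the truth tables satisfy ⋂ B_i ⊆ B. Conversely,
-- if ⋂ B_i ⊆ B then the product M of those α_i lies below β, so
-- β ~ β ∘ M ≡_Γ β ∘ 1 ~ 1.
module Submission where

open import Defs
open import Data.Nat using (ℕ; suc; _^_)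
open import Data.Fin using (Fin)
open import Data.Fin.Subset using (Subset; _∈_)
open import Data.List using (List)
open import Data.List.Relation.Unary.All using (All)
open import Data.Product using (Σ; ∃-syntax; _×_; proj₁; proj₂)
open import Function.Bundles using (_⇔_)

open import Level using (0ℓ)
open import Data.Nat using (zero; _≤_; _<_; s≤s; _⊔_; _*_; _+_; _/_; _%_; _≡ᵇ_)
open import Data.Nat.Properties using (_<?_; m≤m⊔n; m≤n⊔m; *-comm; +-suc; n<1⇒n≡0)
open import Data.Nat.DivMod using (m≡m%n+[m/n]*n; [m+kn]%n≡m%n; m*n%n≡0; m*n/n≡m; m%n<n; +-distrib-/-∣ʳ; m<n*o⇒m/o<n)
open import Data.Nat.Divisibility using (n∣m*n)
open import Data.Fin as F using (toℕ; inject≤; fromℕ<)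
open import Data.Fin.Properties using (toℕ-injective; toℕ<n; fromℕ<-toℕ; toℕ-inject≤)
open import Data.Fin.Subset using (⊤)
open import Data.Bool using (Bool; true; false; _∧_; _∨_; not; if_then_else_)
open import Data.Bool.Properties
  using (∨-assoc; ∨-comm; ∨-idem; ∨-zeroʳ; ∨-inverseʳ; ∧-assoc; ∧-comm; ∧-identityʳ; ∧-zeroʳ; ∧-inverseʳ;
         ∧-distribˡ-∨; ∧-distribʳ-∨; ∧-conicalˡ; ∧-conicalʳ)
open import Data.Vec using ([]; _∷_; tabulate)
open import Data.Vec.Properties using (tabulate-cong; lookup∘tabulate; []=⇒lookup; lookup⇒[]=)
open import Data.Vec.Base using (here; there)
open import Data.List using ([]; _∷_; _++_; map)
import Data.List.Relation.Unary.All as All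
open import Data.List.Relation.Unary.All using ([]; _∷_)
open import Data.List.Relation.Unary.All.Properties using (++⁻; map⁺; map⁻)
open import Data.List.Extrema.Nat using (max; ⊥≤max; xs≤max)
open import Data.Product as Product using (∃; _,_)
open import Data.Empty using (⊥-elim)
open import Relation.Nullary using (yes; no)
open import Relation.Binary.Bundles using (Setoid)
import Relation.Binary.Reasoning.Setoid as SetoidReasoning
open import Relation.Binary.PropositionalEquality using (_≡_; refl; cong; cong₂; sym; trans; subst; module ≡-Reasoning)
open import Function.Bundles using (mk⇔)

≈-setoid : ℕ → Setoid 0ℓ 0ℓ
≈-setoid N = record
  { Carrier       = Term N
  ; _≈_           = _≈_
  ; isEquivalence = record { refl = ≈-refl ; sym = ≈-sym ; trans = ≈-trans }
  }

module ≈-Reasoning {N : ℕ} = SetoidReasoning (≈-setoid N)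

≈-reflexive : ∀ {N} {a b : Term N} → a ≡ b → a ≈ b
≈-reflexive refl = ≈-refl

∘-identʳ : ∀ {N} (a : Term N) → a ∘ θ ≈ a
∘-identʳ a = ≈-trans (∘-comm a θ) (∘-identˡ a)

complemented⇒·-idem : ∀ {N} {a b : Term N} → a · b ≈ θ → a ∘ b ≈ one → a · a ≈ a
complemented⇒·-idem {a = a} {b} ab≈θ a∘b≈1 = ≈-sym (begin
  a                 ≈⟨ ·-identʳ a ⟨
  a · one           ≈⟨ ·-cong ≈-refl a∘b≈1 ⟨
  a · (a ∘ b)       ≈⟨ distribˡ a a b ⟩
  a · a ∘ a · b     ≈⟨ ∘-cong ≈-refl ab≈θ ⟩
  a · a ∘ θ         ≈⟨ ∘-identʳ (a · a) ⟩
  a · a             ∎)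
  where open ≈-Reasoning

var-·-idem : ∀ {N} (i : Fin N) → var i · var i ≈ var i
var-·-idem i = complemented⇒·-idem (compl-· i) (compl-∘ i)

cvar-·-idem : ∀ {N} (i : Fin N) → cvar i · cvar i ≈ cvar i
cvar-·-idem i =
  complemented⇒·-idem (≈-trans (·-comm _ _) (compl-· i)) (≈-trans (∘-comm _ _) (compl-∘ i))

∘-interchange : ∀ {N} (a b c d : Term N) → (a ∘ b) ∘ (c ∘ d) ≈ (a ∘ c) ∘ (b ∘ d)
∘-interchange a b c d = begin
  (a ∘ b) ∘ (c ∘ d)   ≈⟨ ∘-assoc a b (c ∘ d) ⟩
  a ∘ (b ∘ (c ∘ d))   ≈⟨ ∘-cong ≈-refl (∘-assoc b c d) ⟨
  a ∘ ((b ∘ c) ∘ d)   ≈⟨ ∘-cong ≈-refl (∘-cong (∘-comm b c) ≈-refl) ⟩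
  a ∘ ((c ∘ b) ∘ d)   ≈⟨ ∘-cong ≈-refl (∘-assoc c b d) ⟩
  a ∘ (c ∘ (b ∘ d))   ≈⟨ ∘-assoc a c (b ∘ d) ⟨
  (a ∘ c) ∘ (b ∘ d)   ∎
  where open ≈-Reasoning

-- Needs a generator: Term 0 modulo ≈ is the free commutative semiring ℕ, where 1 ∘ 1 ≠ 1.
one-∘-idem : ∀ {n} → one ∘ one ≈ one {suc n}
one-∘-idem = begin
  one ∘ one                   ≈⟨ ∘-cong (compl-∘ x) (compl-∘ x) ⟨
  (var x ∘ cvar x) ∘ (var x ∘ cvar x) ≈⟨ ∘-interchange _ _ _ _ ⟩
  (var x ∘ var x) ∘ (cvar x ∘ cvar x) ≈⟨ ∘-cong (idem x) (idemᶜ x) ⟩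
  var x ∘ cvar x              ≈⟨ compl-∘ x ⟩
  one                         ∎
  where open ≈-Reasoning
        x = F.zero

∘-idem : ∀ {n} (a : Term (suc n)) → a ∘ a ≈ a
∘-idem a = begin
  a ∘ a               ≈⟨ ∘-cong (·-identʳ a) (·-identʳ a) ⟨
  a · one ∘ a · one   ≈⟨ distribˡ a one one ⟨
  a · (one ∘ one)     ≈⟨ ·-cong ≈-refl one-∘-idem ⟩
  a · one             ≈⟨ ·-identʳ a ⟩
  a                   ∎
  where open ≈-Reasoning

⟦_⟧ : ∀ {N} → Term N → (Fin N → Bool) → Bool
⟦ var i  ⟧ ρ = ρ i
⟦ cvar i ⟧ ρ = not (ρ i)
⟦ θ      ⟧ ρ = false
⟦ one    ⟧ ρ = true
⟦ a ∘ b  ⟧ ρ = ⟦ a ⟧ ρ ∨ ⟦ b ⟧ ρ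
⟦ a · b  ⟧ ρ = ⟦ a ⟧ ρ ∧ ⟦ b ⟧ ρ

sound : ∀ {N} {a b : Term N} → a ≈ b → ∀ ρ → ⟦ a ⟧ ρ ≡ ⟦ b ⟧ ρ
sound ≈-refl             ρ = refl
sound (≈-sym e)          ρ = sym (sound e ρ)
sound (≈-trans e f)      ρ = trans (sound e ρ) (sound f ρ)
sound (∘-cong e f)       ρ = cong₂ _∨_ (sound e ρ) (sound f ρ)
sound (·-cong e f)       ρ = cong₂ _∧_ (sound e ρ) (sound f ρ)
sound (∘-assoc a b c)    ρ = ∨-assoc (⟦ a ⟧ ρ) (⟦ b ⟧ ρ) (⟦ c ⟧ ρ)
sound (∘-comm a b)       ρ = ∨-comm (⟦ a ⟧ ρ) (⟦ b ⟧ ρ)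
sound (∘-identˡ a)       ρ = refl
sound (·-assoc a b c)    ρ = ∧-assoc (⟦ a ⟧ ρ) (⟦ b ⟧ ρ) (⟦ c ⟧ ρ)
sound (·-comm a b)       ρ = ∧-comm (⟦ a ⟧ ρ) (⟦ b ⟧ ρ)
sound (·-identˡ a)       ρ = refl
sound (·-identʳ a)       ρ = ∧-identityʳ (⟦ a ⟧ ρ)
sound (distribˡ a b c)   ρ = ∧-distribˡ-∨ (⟦ a ⟧ ρ) (⟦ b ⟧ ρ) (⟦ c ⟧ ρ)
sound (distribʳ a b c)   ρ = ∧-distribʳ-∨ (⟦ a ⟧ ρ) (⟦ b ⟧ ρ) (⟦ c ⟧ ρ)
sound (zeroˡ a)          ρ = refl
sound (zeroʳ a)          ρ = ∧-zeroʳ (⟦ a ⟧ ρ)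
sound (compl-· i)        ρ = ∧-inverseʳ (ρ i)
sound (compl-∘ i)        ρ = ∨-inverseʳ (ρ i)
sound (idem i)           ρ = ∨-idem (ρ i)
sound (idemᶜ i)          ρ = ∨-idem (not (ρ i))

if-·ˡ : ∀ {N} (c : Bool) (a b : Term N) → (if c then a else θ) · b ≈ (if c then a · b else θ)
if-·ˡ true  a b = ≈-refl
if-·ˡ false a b = zeroˡ b

·-ifʳ : ∀ {N} (c : Bool) (a b : Term N) → a · (if c then b else θ) ≈ (if c then a · b else θ)
·-ifʳ true  a b = ≈-refl
·-ifʳ false a b = zeroʳ a

if-∘ : ∀ {n} (c d : Bool) (a : Term (suc n)) →
       (if c then a else θ) ∘ (if d then a else θ) ≈ (if c ∨ d then a else θ)
if-∘ true  true  a = ∘-idem a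
if-∘ true  false a = ∘-identʳ a
if-∘ false true  a = ∘-identˡ a
if-∘ false false a = ∘-identˡ θ

if-·-absorb : ∀ {N} (c d : Bool) {a b : Term N} → a · b ≈ (if d then a else θ) →
              (if c then a else θ) · b ≈ (if c ∧ d then a else θ)
if-·-absorb true  d ab = ab
if-·-absorb false d ab = zeroˡ _

prod-·-absorb : ∀ {M} n (f : Fin n → Term M) (i : Fin n) (c : Bool) {t : Term M} →
                f i · t ≈ (if c then f i else θ) → prod n f · t ≈ (if c then prod n f else θ)
prod-·-absorb (suc n) f F.zero c {t} fi·t = begin
  (f F.zero · P) · t               ≈⟨ ·-assoc _ P t ⟩
  f F.zero · (P · t)               ≈⟨ ·-cong ≈-refl (·-comm P t) ⟩
  f F.zero · (t · P)               ≈⟨ ·-assoc _ t P ⟨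
  (f F.zero · t) · P               ≈⟨ ·-cong fi·t ≈-refl ⟩
  (if c then f F.zero else θ) · P  ≈⟨ if-·ˡ c _ P ⟩
  (if c then f F.zero · P else θ)  ∎
  where open ≈-Reasoning
        P = prod n (λ j → f (F.suc j))
prod-·-absorb (suc n) f (F.suc i) c {t} fi·t = begin
  (f F.zero · P) · t               ≈⟨ ·-assoc _ P t ⟩
  f F.zero · (P · t)               ≈⟨ ·-cong ≈-refl (prod-·-absorb n (λ j → f (F.suc j)) i c fi·t) ⟩
  f F.zero · (if c then P else θ)  ≈⟨ ·-ifʳ c _ P ⟩
  (if c then f F.zero · P else θ)  ∎
  where open ≈-Reasoning
        P = prod n (λ j → f (F.suc j))

lit-·-var : ∀ {M} (l : Fin M) b → lit l b · var l ≈ (if b then lit l b else θ)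
lit-·-var l true  = var-·-idem l
lit-·-var l false = ≈-trans (·-comm _ _) (compl-· l)

lit-·-cvar : ∀ {M} (l : Fin M) b → lit l b · cvar l ≈ (if not b then lit l b else θ)
lit-·-cvar l true  = compl-· l
lit-·-cvar l false = cvar-·-idem l

minterm : ∀ {N} → (Fin N → Bool) → Term N
minterm {N} ρ = prod N (λ l → lit l (ρ l))

minterm-· : ∀ {n} (ρ : Fin (suc n) → Bool) (a : Term (suc n)) →
            minterm ρ · a ≈ (if ⟦ a ⟧ ρ then minterm ρ else θ)
minterm-· ρ (var i)  = prod-·-absorb _ (λ l → lit l (ρ l)) i (ρ i) (lit-·-var i (ρ i))
minterm-· ρ (cvar i) = prod-·-absorb _ (λ l → lit l (ρ l)) i (not (ρ i)) (lit-·-cvar i (ρ i))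
minterm-· ρ θ        = zeroʳ _
minterm-· ρ one      = ·-identʳ _
minterm-· ρ (a ∘ b)  = begin
  minterm ρ · (a ∘ b)                       ≈⟨ distribˡ _ a b ⟩
  minterm ρ · a ∘ minterm ρ · b             ≈⟨ ∘-cong (minterm-· ρ a) (minterm-· ρ b) ⟩
  (if ⟦ a ⟧ ρ then minterm ρ else θ) ∘ (if ⟦ b ⟧ ρ then minterm ρ else θ)
                                            ≈⟨ if-∘ (⟦ a ⟧ ρ) (⟦ b ⟧ ρ) _ ⟩
  (if ⟦ a ⟧ ρ ∨ ⟦ b ⟧ ρ then minterm ρ else θ) ∎
  where open ≈-Reasoning
minterm-· ρ (a · b)  = begin
  minterm ρ · (a · b)                       ≈⟨ ·-assoc _ a b ⟨
  (minterm ρ · a) · b                       ≈⟨ ·-cong (minterm-· ρ a) ≈-refl ⟩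
  (if ⟦ a ⟧ ρ then minterm ρ else θ) · b    ≈⟨ if-·-absorb (⟦ a ⟧ ρ) (⟦ b ⟧ ρ) (minterm-· ρ b) ⟩
  (if ⟦ a ⟧ ρ ∧ ⟦ b ⟧ ρ then minterm ρ else θ) ∎
  where open ≈-Reasoning

sumSub-cong : ∀ {M n} (D : Subset n) {f g : Fin n → Term M} → (∀ k → f k ≈ g k) → sumSub D f ≈ sumSub D g
sumSub-cong []          f≈g = ≈-refl
sumSub-cong (true  ∷ D) f≈g = ∘-cong (f≈g F.zero) (sumSub-cong D (λ k → f≈g (F.suc k)))
sumSub-cong (false ∷ D) f≈g = sumSub-cong D (λ k → f≈g (F.suc k))

·-distribˡ-sumSub : ∀ {M n} (a : Term M) (D : Subset n) (f : Fin n → Term M) →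
                    a · sumSub D f ≈ sumSub D (λ k → a · f k)
·-distribˡ-sumSub a []          f = zeroʳ a
·-distribˡ-sumSub a (true  ∷ D) f =
  ≈-trans (distribˡ _ _ _) (∘-cong ≈-refl (·-distribˡ-sumSub a D (λ k → f (F.suc k))))
·-distribˡ-sumSub a (false ∷ D) f = ·-distribˡ-sumSub a D (λ k → f (F.suc k))

sumSub-⊤-if : ∀ {M} n (t : Fin n → Bool) (f : Fin n → Term M) →
              sumSub ⊤ (λ k → if t k then f k else θ) ≈ sumSub (tabulate t) f
sumSub-⊤-if zero    t f = ≈-refl
sumSub-⊤-if (suc n) t f with t F.zero
... | true  = ∘-cong ≈-refl (sumSub-⊤-if n (λ k → t (F.suc k)) (λ k → f (F.suc k)))
... | false = ≈-trans (∘-identˡ _) (sumSub-⊤-if n (λ k → t (F.suc k)) (λ k → f (F.suc k)))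

sumUpTo : ∀ {M} → ℕ → (ℕ → Term M) → Term M
sumUpTo zero    h = θ
sumUpTo (suc m) h = h 0 ∘ sumUpTo m (λ j → h (suc j))

sumSub-⊤≡sumUpTo : ∀ {M} m (h : ℕ → Term M) → sumSub (⊤ {m}) (λ k → h (toℕ k)) ≡ sumUpTo m h
sumSub-⊤≡sumUpTo zero    h = refl
sumSub-⊤≡sumUpTo (suc m) h = cong (h 0 ∘_) (sumSub-⊤≡sumUpTo m (λ j → h (suc j)))

sumUpTo-cong : ∀ {M} m {h h' : ℕ → Term M} → (∀ j → h j ≈ h' j) → sumUpTo m h ≈ sumUpTo m h'
sumUpTo-cong zero    h≈h' = ≈-refl
sumUpTo-cong (suc m) h≈h' = ∘-cong (h≈h' 0) (sumUpTo-cong m (λ j → h≈h' (suc j)))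

sumUpTo-pairs : ∀ {M} m (h : ℕ → Term M) →
                sumUpTo (2 * m) h ≈ sumUpTo m (λ j → h (j * 2) ∘ h (suc (j * 2)))
sumUpTo-pairs zero    h = ≈-refl
sumUpTo-pairs (suc m) h = begin
  sumUpTo (2 * suc m) h                                  ≡⟨ cong (λ k → sumUpTo (suc k) h) (+-suc m (m + 0)) ⟩
  h 0 ∘ (h 1 ∘ sumUpTo (2 * m) (λ j → h (2 + j)))        ≈⟨ ∘-assoc _ _ _ ⟨
  (h 0 ∘ h 1) ∘ sumUpTo (2 * m) (λ j → h (2 + j))        ≈⟨ ∘-cong ≈-refl (sumUpTo-pairs m (λ j → h (2 + j))) ⟩
  sumUpTo (suc m) (λ j → h (j * 2) ∘ h (suc (j * 2)))    ∎
  where open ≈-Reasoning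

-- y′ σ j is y_j with x_l renamed to x_{σ l}, so that y N k = y′ id (toℕ k); the renaming
-- lets the induction below peel off the first generator.
y′ : ∀ {N M} → (Fin N → Fin M) → ℕ → Term M
y′ {N} σ j = prod N (λ l → lit (σ l) (testBit j (toℕ l)))

y′-even : ∀ {N M} (σ : Fin (suc N) → Fin M) j →
          y′ σ (j * 2) ≡ cvar (σ F.zero) · y′ (λ l → σ (F.suc l)) j
y′-even σ j = cong₂ (λ b i → lit (σ F.zero) b · y′ (λ l → σ (F.suc l)) i)
                    (cong (_≡ᵇ 1) (m*n%n≡0 j 2)) (m*n/n≡m j 2)

y′-odd : ∀ {N M} (σ : Fin (suc N) → Fin M) j →
         y′ σ (suc (j * 2)) ≡ var (σ F.zero) · y′ (λ l → σ (F.suc l)) j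
y′-odd σ j = cong₂ (λ b i → lit (σ F.zero) b · y′ (λ l → σ (F.suc l)) i)
                   (cong (_≡ᵇ 1) ([m+kn]%n≡m%n 1 j 2))
                   (trans (+-distrib-/-∣ʳ 1 (n∣m*n j {2})) (m*n/n≡m j 2))

y′-pair : ∀ {N M} (σ : Fin (suc N) → Fin M) j →
          y′ σ (j * 2) ∘ y′ σ (suc (j * 2)) ≈ y′ (λ l → σ (F.suc l)) j
y′-pair σ j = begin
  y′ σ (j * 2) ∘ y′ σ (suc (j * 2))   ≡⟨ cong₂ _∘_ (y′-even σ j) (y′-odd σ j) ⟩
  cvar x · Y ∘ var x · Y             ≈⟨ distribʳ Y (cvar x) (var x) ⟨
  (cvar x ∘ var x) · Y               ≈⟨ ·-cong (≈-trans (∘-comm _ _) (compl-∘ x)) ≈-refl ⟩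
  one · Y                            ≈⟨ ·-identˡ Y ⟩
  Y                                  ∎
  where open ≈-Reasoning
        x = σ F.zero
        Y = y′ (λ l → σ (F.suc l)) j

one≈sumUpTo-y′ : ∀ {M} N (σ : Fin N → Fin M) → one ≈ sumUpTo (2 ^ N) (y′ σ)
one≈sumUpTo-y′ zero    σ = ≈-sym (∘-identʳ one)
one≈sumUpTo-y′ (suc N) σ = begin
  one                                                      ≈⟨ one≈sumUpTo-y′ N (λ l → σ (F.suc l)) ⟩
  sumUpTo (2 ^ N) (y′ (λ l → σ (F.suc l)))                  ≈⟨ sumUpTo-cong (2 ^ N) (y′-pair σ) ⟨
  sumUpTo (2 ^ N) (λ j → y′ σ (j * 2) ∘ y′ σ (suc (j * 2))) ≈⟨ sumUpTo-pairs (2 ^ N) (y′ σ) ⟨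
  sumUpTo (2 ^ suc N) (y′ σ)                                ∎
  where open ≈-Reasoning

one≈sumSub-⊤-y : ∀ N → one ≈ sumSub ⊤ (y N)
one≈sumSub-⊤-y N =
  ≈-trans (one≈sumUpTo-y′ N (λ l → l)) (≈-reflexive (sym (sumSub-⊤≡sumUpTo (2 ^ N) (y′ (λ l → l)))))

env : ∀ {N} → Fin (2 ^ N) → Fin N → Bool
env k l = testBit (toℕ k) (toℕ l)

table : ∀ {N} → Term N → Subset (2 ^ N)
table a = tabulate (λ k → ⟦ a ⟧ (env k))

≈-normalForm : ∀ {n} (a : Term (suc n)) → a ≈ sumSub (table a) (y (suc n))
≈-normalForm {n} a = begin
  a                                                 ≈⟨ ·-identʳ a ⟨
  a · one                                           ≈⟨ ·-cong ≈-refl (one≈sumSub-⊤-y (suc n)) ⟩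
  a · sumSub ⊤ Y                                    ≈⟨ ·-distribˡ-sumSub a ⊤ Y ⟩
  sumSub ⊤ (λ k → a · Y k)                          ≈⟨ sumSub-cong ⊤ (λ k → ≈-trans (·-comm a (Y k)) (minterm-· (env k) a)) ⟩
  sumSub ⊤ (λ k → if ⟦ a ⟧ (env k) then Y k else θ) ≈⟨ sumSub-⊤-if _ (λ k → ⟦ a ⟧ (env k)) Y ⟩
  sumSub (table a) Y                                ∎
  where open ≈-Reasoning
        Y = y (suc n)

≈-complete : ∀ {n} {a b : Term (suc n)} → (∀ ρ → ⟦ a ⟧ ρ ≡ ⟦ b ⟧ ρ) → a ≈ b
≈-complete {n} {a} {b} a≗b = begin
  a                            ≈⟨ ≈-normalForm a ⟩
  sumSub (table a) (y (suc n)) ≡⟨ cong (λ D → sumSub D (y (suc n))) (tabulate-cong (λ k → a≗b (env k))) ⟩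
  sumSub (table b) (y (suc n)) ≈⟨ ≈-normalForm b ⟨
  b                            ∎
  where open ≈-Reasoning

sumSub-true⇒∃ : ∀ {M n} (D : Subset n) (f : Fin n → Term M) ρ → ⟦ sumSub D f ⟧ ρ ≡ true →
                ∃ λ k → k ∈ D × ⟦ f k ⟧ ρ ≡ true
sumSub-true⇒∃ (true ∷ D) f ρ sum-true with ⟦ f F.zero ⟧ ρ in f₀≡
... | true  = F.zero , here , f₀≡
... | false = Product.map F.suc (Product.map₁ there) (sumSub-true⇒∃ D (λ k → f (F.suc k)) ρ sum-true)
sumSub-true⇒∃ (false ∷ D) f ρ sum-true =
  Product.map F.suc (Product.map₁ there) (sumSub-true⇒∃ D (λ k → f (F.suc k)) ρ sum-true)

∈⇒sumSub-true : ∀ {M n} (D : Subset n) (f : Fin n → Term M) ρ {k} → k ∈ D → ⟦ f k ⟧ ρ ≡ true →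
                ⟦ sumSub D f ⟧ ρ ≡ true
∈⇒sumSub-true (true ∷ D) f ρ here fk-true = cong (_∨ ⟦ sumSub D (λ k → f (F.suc k)) ⟧ ρ) fk-true
∈⇒sumSub-true (true ∷ D) f ρ (there k∈D) fk-true =
  trans (cong (_ ∨_) (∈⇒sumSub-true D (λ k → f (F.suc k)) ρ k∈D fk-true)) (∨-zeroʳ _)
∈⇒sumSub-true (false ∷ D) f ρ (there k∈D) fk-true = ∈⇒sumSub-true D (λ k → f (F.suc k)) ρ k∈D fk-true

prod-true⇒factor-true : ∀ {M} n (f : Fin n → Term M) ρ → ⟦ prod n f ⟧ ρ ≡ true → ∀ i → ⟦ f i ⟧ ρ ≡ true
prod-true⇒factor-true (suc n) f ρ prod-true F.zero    = ∧-conicalˡ _ _ prod-true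
prod-true⇒factor-true (suc n) f ρ prod-true (F.suc i) =
  prod-true⇒factor-true n (λ j → f (F.suc j)) ρ (∧-conicalʳ _ _ prod-true) i

lit-true : ∀ {M} (l : Fin M) b ρ → ⟦ lit l b ⟧ ρ ≡ true → b ≡ ρ l
lit-true l true  ρ ρl-true = sym ρl-true
lit-true l false ρ ¬ρl-true with ρ l
... | false = refl

≡ᵇ1-injective-<2 : ∀ {x x'} → x < 2 → x' < 2 → (x ≡ᵇ 1) ≡ (x' ≡ᵇ 1) → x ≡ x'
≡ᵇ1-injective-<2 {0} {0} _ _ _ = refl
≡ᵇ1-injective-<2 {1} {1} _ _ _ = refl
≡ᵇ1-injective-<2 {0} {1} _ _ ()
≡ᵇ1-injective-<2 {1} {0} _ _ ()
≡ᵇ1-injective-<2 {suc (suc _)} (s≤s (s≤s ())) _ _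
≡ᵇ1-injective-<2 {x' = suc (suc _)} _ (s≤s (s≤s ())) _

testBit-injective : ∀ N {k k'} → k < 2 ^ N → k' < 2 ^ N →
                    (∀ (l : Fin N) → testBit k (toℕ l) ≡ testBit k' (toℕ l)) → k ≡ k'
testBit-injective zero    k<1 k'<1 _ = trans (n<1⇒n≡0 k<1) (sym (n<1⇒n≡0 k'<1))
testBit-injective (suc N) {k} {k'} k<2^N k'<2^N same-bits = begin
  k                     ≡⟨ m≡m%n+[m/n]*n k 2 ⟩
  k % 2 + (k / 2) * 2   ≡⟨ cong₂ (λ r q → r + q * 2) same-rem same-quot ⟩
  k' % 2 + (k' / 2) * 2 ≡⟨ m≡m%n+[m/n]*n k' 2 ⟨
  k'                    ∎
  where
  open ≡-Reasoning
  half< : ∀ {j} → j < 2 ^ suc N → j / 2 < 2 ^ N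
  half< {j} j< = m<n*o⇒m/o<n (subst (j <_) (*-comm 2 (2 ^ N)) j<)
  same-rem : k % 2 ≡ k' % 2
  same-rem = ≡ᵇ1-injective-<2 (m%n<n k 2) (m%n<n k' 2) (same-bits F.zero)
  same-quot : k / 2 ≡ k' / 2
  same-quot = testBit-injective N (half< k<2^N) (half< k'<2^N) (λ l → same-bits (F.suc l))

y-true-unique : ∀ N {k k' : Fin (2 ^ N)} ρ → ⟦ y N k ⟧ ρ ≡ true → ⟦ y N k' ⟧ ρ ≡ true → k ≡ k'
y-true-unique N {k} {k'} ρ yk-true yk'-true =
  toℕ-injective (testBit-injective N (toℕ<n k) (toℕ<n k') λ l → trans (bit yk-true l) (sym (bit yk'-true l)))
  where
  bit : ∀ {j} → ⟦ y N j ⟧ ρ ≡ true → ∀ l → testBit (toℕ j) (toℕ l) ≡ ρ l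
  bit yj-true l = lit-true l _ ρ (prod-true⇒factor-true N _ ρ yj-true l)

y-true-exists : ∀ N (ρ : Fin N → Bool) → ∃ λ k → ⟦ y N k ⟧ ρ ≡ true
y-true-exists N ρ = Product.map₂ proj₂ (sumSub-true⇒∃ ⊤ (y N) ρ (sym (sound (one≈sumSub-⊤-y N) ρ)))

sumSub-y-true⇒∈ : ∀ N (D : Subset (2 ^ N)) ρ {k} → ⟦ y N k ⟧ ρ ≡ true → ⟦ sumSub D (y N) ⟧ ρ ≡ true → k ∈ D
sumSub-y-true⇒∈ N D ρ yk-true sum-true with sumSub-true⇒∃ D (y N) ρ sum-true
... | j , j∈D , yj-true = subst (_∈ D) (y-true-unique N ρ yj-true yk-true) j∈D

emb-sem : ∀ {N M} (p : N ≤ M) (a : Term N) {ρ : Fin M → Bool} {ρ' : Fin N → Bool} →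
          (∀ i → ρ (inject≤ i p) ≡ ρ' i) → ⟦ emb p a ⟧ ρ ≡ ⟦ a ⟧ ρ'
emb-sem p (var i)  ρ≗ρ' = ρ≗ρ' i
emb-sem p (cvar i) ρ≗ρ' = cong not (ρ≗ρ' i)
emb-sem p θ        ρ≗ρ' = refl
emb-sem p one      ρ≗ρ' = refl
emb-sem p (a ∘ b)  ρ≗ρ' = cong₂ _∨_ (emb-sem p a ρ≗ρ') (emb-sem p b ρ≗ρ')
emb-sem p (a · b)  ρ≗ρ' = cong₂ _∧_ (emb-sem p a ρ≗ρ') (emb-sem p b ρ≗ρ')

-- An assignment ρ : ℕ → Bool sets x_{j+1} to ρ j.
⟦_⟧X : ScX → (ℕ → Bool) → Bool
⟦ (n , a) ⟧X ρ = ⟦ a ⟧ (λ i → ρ (toℕ i))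

emb-semX : ∀ {N M} (p : N ≤ M) (a : Term N) (ρ : ℕ → Bool) →
           ⟦ emb p a ⟧ (λ i → ρ (toℕ i)) ≡ ⟦ a ⟧ (λ i → ρ (toℕ i))
emb-semX p a ρ = emb-sem p a (λ i → cong ρ (toℕ-inject≤ i p))

~-sound : ∀ {a b} → a ~ b → ∀ ρ → ⟦ a ⟧X ρ ≡ ⟦ b ⟧X ρ
~-sound {n , a} {m , b} (k , p , q , e) ρ =
  trans (sym (emb-semX p a ρ)) (trans (sound e (λ i → ρ (toℕ i))) (emb-semX q b ρ))

extend : ∀ {K} → (Fin K → Bool) → ℕ → Bool
extend {K} ρ j with j <? K
... | yes j<K = ρ (fromℕ< j<K)
... | no  _   = false

extend-toℕ : ∀ {K} (ρ : Fin K → Bool) (i : Fin K) → extend ρ (toℕ i) ≡ ρ i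
extend-toℕ {K} ρ i with toℕ i <? K
... | yes i<K = cong ρ (fromℕ<-toℕ i i<K)
... | no  i≮K = ⊥-elim (i≮K (toℕ<n i))

~-complete : ∀ {a b} → (∀ ρ → ⟦ a ⟧X ρ ≡ ⟦ b ⟧X ρ) → a ~ b
~-complete {n , a} {m , b} a≗b = suc (n ⊔ m) , p , q , ≈-complete λ ρ →
    trans (emb-extend p a ρ) (trans (a≗b (extend ρ)) (sym (emb-extend q b ρ)))
  where
  p = s≤s (m≤m⊔n n m)
  q = s≤s (m≤n⊔m n m)
  emb-extend : ∀ {N K} (r : N ≤ K) (t : Term N) (ρ : Fin K → Bool) →
               ⟦ emb r t ⟧ ρ ≡ ⟦ t ⟧ (λ i → extend ρ (toℕ i))
  emb-extend r t ρ =
    emb-sem r t (λ i → trans (sym (extend-toℕ ρ (inject≤ i r))) (cong (extend ρ) (toℕ-inject≤ i r)))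

~-refl : ∀ a → a ~ a
~-refl a = ~-complete {a} {a} λ _ → refl

⊕-sem : ∀ a b ρ → ⟦ a ⊕ b ⟧X ρ ≡ ⟦ a ⟧X ρ ∨ ⟦ b ⟧X ρ
⊕-sem (n , a) (m , b) ρ = cong₂ _∨_ (emb-semX _ a ρ) (emb-semX _ b ρ)

⊗-sem : ∀ a b ρ → ⟦ a ⊗ b ⟧X ρ ≡ ⟦ a ⟧X ρ ∧ ⟦ b ⟧X ρ
⊗-sem (n , a) (m , b) ρ = cong₂ _∧_ (emb-semX _ a ρ) (emb-semX _ b ρ)

tableX : (n : ℕ) → ScX → Subset (2 ^ suc n)
tableX n a = tabulate (λ k → ⟦ a ⟧X (testBit (toℕ k)))

~-nf-tableX : ∀ n (a : ScX) → proj₁ a ≤ n → a ~ nf n (tableX n a)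
~-nf-tableX n (m , t) m≤n = ~-complete λ ρ → begin
  ⟦ t ⟧ (λ i → ρ (toℕ i))                      ≡⟨ emb-semX p t ρ ⟨
  ⟦ emb p t ⟧ (λ i → ρ (toℕ i))                ≡⟨ sound (≈-normalForm (emb p t)) _ ⟩
  ⟦ sumSub (table (emb p t)) Y ⟧ (λ i → ρ (toℕ i))
      ≡⟨ cong (λ D → ⟦ sumSub D Y ⟧ (λ i → ρ (toℕ i))) (tabulate-cong (λ k → emb-semX p t (testBit (toℕ k)))) ⟩
  ⟦ sumSub (tableX n (m , t)) Y ⟧ (λ i → ρ (toℕ i)) ∎
  where open ≡-Reasoning
        p = s≤s m≤n
        Y = y (suc n)

∈-tabulate⁻ : ∀ {m} {g : Fin m → Bool} {k} → k ∈ tabulate g → g k ≡ true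
∈-tabulate⁻ {g = g} {k} k∈ = trans (sym (lookup∘tabulate g k)) ([]=⇒lookup k∈)

∈-tabulate⁺ : ∀ {m} {g : Fin m → Bool} {k} → g k ≡ true → k ∈ tabulate g
∈-tabulate⁺ {g = g} {k} gk-true = lookup⇒[]= k _ (trans (lookup∘tabulate g k) gk-true)

∨-absorbs-implied : ∀ {b m} → (m ≡ true → b ≡ true) → b ∨ m ≡ b
∨-absorbs-implied {b}     {true}  m⇒b = trans (∨-zeroʳ b) (sym (m⇒b refl))
∨-absorbs-implied {false} {false} m⇒b = refl
∨-absorbs-implied {true}  {false} m⇒b = refl

module _ {I : Set} (α : I → ScX) where

  Satisfies : List I → (ℕ → Bool) → Set
  Satisfies L ρ = All (λ i → ⟦ α i ⟧X ρ ≡ true) L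

  FinitelyEntailed : ((ℕ → Bool) → Set) → Set
  FinitelyEntailed P = ∃ λ L → ∀ ρ → Satisfies L ρ → P ρ

  zipEntailed : ∀ {P Q R : (ℕ → Bool) → Set} → (∀ {ρ} → P ρ → Q ρ → R ρ) →
                FinitelyEntailed P → FinitelyEntailed Q → FinitelyEntailed R
  zipEntailed f (L₁ , P-valid) (L₂ , Q-valid) = L₁ ++ L₂ , λ ρ sat →
    let sat₁ , sat₂ = ++⁻ L₁ sat in f (P-valid ρ sat₁) (Q-valid ρ sat₂)

  ≡[]-sound : ∀ {a b} → a ≡[ α ] b → FinitelyEntailed (λ ρ → ⟦ a ⟧X ρ ≡ ⟦ b ⟧X ρ)
  ≡[]-sound (gen i)       = i ∷ [] , λ { ρ (αi-true ∷ []) → αi-true }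
  ≡[]-sound (≡-eq a~b)    = [] , λ ρ _ → ~-sound a~b ρ
  ≡[]-sound (≡-sym d)     = Product.map₂ (λ valid ρ sat → sym (valid ρ sat)) (≡[]-sound d)
  ≡[]-sound (≡-trans d e) = zipEntailed trans (≡[]-sound d) (≡[]-sound e)
  ≡[]-sound (⊕-cong {a = a} {a'} {b} {b'} d e) = zipEntailed
    (λ {ρ} a≡a' b≡b' → trans (⊕-sem a b ρ) (trans (cong₂ _∨_ a≡a' b≡b') (sym (⊕-sem a' b' ρ))))
    (≡[]-sound d) (≡[]-sound e)
  ≡[]-sound (⊗-cong {a = a} {a'} {b} {b'} d e) = zipEntailed
    (λ {ρ} a≡a' b≡b' → trans (⊗-sem a b ρ) (trans (cong₂ _∧_ a≡a' b≡b') (sym (⊗-sem a' b' ρ))))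
    (≡[]-sound d) (≡[]-sound e)

  Certificate : ScX → ℕ → Set
  Certificate β n = Σ (List (I × Subset (2 ^ suc n))) λ J → Σ (Subset (2 ^ suc n)) λ B →
      All (λ p → α (proj₁ p) ~ nf n (proj₂ p)) J
    × β ~ nf n B
    × ((k : Fin (2 ^ suc n)) → All (λ p → k ∈ proj₂ p) J → k ∈ B)

  -- The level is taken above β and all generators used, and B_i, B are their truth tables.
  ⊢⇒certificate : ∀ {β} → α ⊢ β → ∃ (Certificate β)
  ⊢⇒certificate {β} α⊢β with ≡[]-sound α⊢β
  ... | L , valid = n , map (λ i → i , tableX n (α i)) L , tableX n β
                  , map⁺ (All.map (~-nf-tableX n _) (map⁻ (xs≤max (proj₁ β) levels)))
                  , ~-nf-tableX n β (⊥≤max (proj₁ β) levels)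
                  , λ k k∈⋂ → ∈-tabulate⁺ (valid (testBit (toℕ k)) (All.map ∈-tabulate⁻ (map⁻ k∈⋂)))
    where
    levels = map (λ i → proj₁ (α i)) L
    n = max (proj₁ β) levels

  product : ∀ {B : Set} → List (I × B) → ScX
  product []      = oneX
  product (p ∷ J) = α (proj₁ p) ⊗ product J

  product≡1 : ∀ {B : Set} (J : List (I × B)) → product J ≡[ α ] oneX
  product≡1 []      = ≡-eq (~-refl oneX)
  product≡1 (p ∷ J) = ≡-trans (⊗-cong (gen (proj₁ p)) (product≡1 J)) (≡-eq (~-complete {oneX ⊗ oneX} {oneX} λ _ → refl))

  product-true : ∀ {B : Set} (J : List (I × B)) ρ → ⟦ product J ⟧X ρ ≡ true →
                 All (λ p → ⟦ α (proj₁ p) ⟧X ρ ≡ true) J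
  product-true []      ρ _        = []
  product-true (p ∷ J) ρ prod-true =
    ∧-conicalˡ _ _ αJ-true ∷ product-true J ρ (∧-conicalʳ _ _ αJ-true)
    where αJ-true = trans (sym (⊗-sem (α (proj₁ p)) (product J) ρ)) prod-true

  -- Under ρ exactly one y_k is true; each α_i is then true iff k ∈ B_i, and β iff k ∈ B.
  certificate-product-below : ∀ {β n} ((J , B , α~ , β~ , ⋂⊆B) : Certificate β n) ρ →
                              ⟦ product J ⟧X ρ ≡ true → ⟦ β ⟧X ρ ≡ true
  certificate-product-below {β} {n} (J , B , α~ , β~ , ⋂⊆B) ρ prod-true =
    trans (~-sound β~ ρ) (∈⇒sumSub-true B (y (suc n)) ρₙ (⋂⊆B k k∈Bᵢ) yk-true)
    where
    ρₙ = λ (i : Fin (suc n)) → ρ (toℕ i)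
    k = proj₁ (y-true-exists (suc n) ρₙ)
    yk-true = proj₂ (y-true-exists (suc n) ρₙ)
    k∈Bᵢ : All (λ p → k ∈ proj₂ p) J
    k∈Bᵢ = All.zipWith
      (λ { {_ , Bᵢ} (αᵢ~ , αᵢ-true) → sumSub-y-true⇒∈ (suc n) Bᵢ ρₙ yk-true (trans (sym (~-sound αᵢ~ ρ)) αᵢ-true) })
      (α~ , product-true J ρ prod-true)

  certificate⇒⊢ : ∀ {β n} → Certificate β n → α ⊢ β
  certificate⇒⊢ {β} cert@(J , _) =
    ≡-trans {b = β ⊕ M} (≡-eq β~β⊕M) (≡-trans {b = β ⊕ oneX} (⊕-cong (≡-eq (~-refl β)) (product≡1 J)) (≡-eq β⊕1~1))
    where
    M = product J
    β~β⊕M : β ~ β ⊕ M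
    β~β⊕M = ~-complete λ ρ → sym (trans (⊕-sem β M ρ) (∨-absorbs-implied (certificate-product-below cert ρ)))
    β⊕1~1 : β ⊕ oneX ~ oneX
    β⊕1~1 = ~-complete λ ρ → trans (⊕-sem β oneX ρ) (∨-zeroʳ _)

corollary4p12 : {I : Set} (α : I → ScX) (β : ScX) →
    (α ⊢ β) ⇔
    (∃[ n ] Σ (List (I × Subset (2 ^ suc n))) (λ J → Σ (Subset (2 ^ suc n)) (λ B →
        All (λ p → α (proj₁ p) ~ nf n (proj₂ p)) J
      × β ~ nf n B
      × ((k : Fin (2 ^ suc n)) → All (λ p → k ∈ proj₂ p) J → k ∈ B))))
corollary4p12 α β = mk⇔ (⊢⇒certificate α) (λ (n , cert) → certificate⇒⊢ α cert)
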